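{- Let $n\in\mathbb{N}^\ast$, and let $\mathcal{S}$, $\boldsymbol{\mathcal{A}}$, $\rho$, $T$ be as in the context. For every $k\in\mathcal{S}$ and all $i,j\in\mathcal{S}$: $$\big(T\rho(\mathbf{k})\big)_{i,j}=1\iff ij\le\lfloor n/k\rfloor\iff k\le\lfloor n/(ij)\rfloor.$$
   Context: Fix $n\in\mathbb{N}^\ast$ and define $i\,\mathcal{R}\,j\iff\lfloor n/i\rfloor=\lfloor n/j\rfloor$ on $\mathbb{N}^\ast$; its classes are intervals, the integers $>n$ form the only unbounded class. $\mathcal{S}$ is the set of largest elements of the bounded classes, $s=\#\mathcal{S}$, and $\mathcal{S}=\{s_1<s_2<\dots<s_s\}$. $\boldsymbol{\mathcal{A}}$ is the free $\mathbb{Z}$-module with basis $\{\mathbf{k}:k\in\mathcal{S}\}$, made into a commutative $\mathbb{Z}$-algebra by the bilinear multiplication: $\mathbf{i}\mathbf{j}=\mathbf{l}$ if $ij\le n$, where $l\in\mathcal{S}$ is the largest element of the class of $ij$, and $\mathbf{i}\mathbf{j}=0$ if $ij>n$. For $\mathbf{a}\in\boldsymbol{\mathcal{A}}$, $\rho(\mathbf{a})$ is the $s\times s$ integer matrix, with rows and columns indexed by $\mathcal{S}$ in increasing order, representing the linear map $\mathbf{x}\mapsto\mathbf{a}\mathbf{x}$ in the basis $(\mathbf{k})_{k\in\mathcal{S}}$ (column $j$ holds the coordinates of $\mathbf{a}\mathbf{j}$). $T$ is the $s\times s$ matrix indexed by $\mathcal{S}$ with $T_{s_p,s_q}=1$ if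 $p+q\le s+1$ and $T_{s_p,s_q}=0$ otherwise (ones on and above the antidiagonal, zeros below). -}

module Defs where

open import Data.Nat using (ℕ; zero; suc; _+_; _*_; _≤_; _≤?_; _/_)
open import Data.Nat.Properties using (_≟_)
open import Data.Integer using (ℤ; +_)
open import Data.List using (List; []; _∷_; filter; length; upTo; map; foldr)
open import Relation.Nullary using (¬?; _×-dec_)
open import Relation.Nullary.Decidable using (⌊_⌋)
open import Data.Bool using (if_then_else_)

-- ⌊ n / k ⌋ (k ≥ 1 whenever used; the value at k = 0 is irrelevant)
dv : ℕ → ℕ → ℕ
dv n zero    = 0
dv n (suc k) = n / suc k

R : ℕ → ℕ → ℕ → Set
R n i j = dv n i ≡ dv n j
  where open import Relation.Binary.PropositionalEquality using (_≡_)

-- The set 𝒮 as the increasing list s₁ < … < s_s.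
-- Bounded classes are exactly those of 1..n; since classes are intervals,
-- k ∈ {1..n} is the largest element of its class iff k+1 is not in it.
Slist : ℕ → List ℕ
Slist n = filter (λ k → ¬? (dv n (suc k) ≟ dv n k)) (map suc (upTo n))

card : ℕ → ℕ
card n = length (Slist n)

-- position p of s_p in 𝒮 (1-based): number of elements of 𝒮 that are ≤ s_p
pos : ℕ → ℕ → ℕ
pos n k = length (filter (λ l → l ≤? k) (Slist n))

-- Matrices indexed by 𝒮 (given as functions on ℕ, only values on 𝒮 matter)
Mat : Set
Mat = ℕ → ℕ → ℤ

mmul : ℕ → Mat → Mat → Mat
mmul n A B i j = foldr (λ l acc → A i l Data.Integer.* B l j Data.Integer.+ acc) (+ 0) (Slist n)
  where import Data.Integer

T : ℕ → Mat
T n a b = if ⌊ pos n a + pos n b ≤? suc (card n) ⌋ then + 1 else + 0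

-- coordinate of the product 𝐢𝐣 on the basis vector 𝐥 (l ∈ 𝒮):
-- 𝐢𝐣 = 𝐥' where l' ∈ 𝒮 is the largest element of the class of ij if ij ≤ n,
-- and 0 otherwise.  For l ∈ 𝒮, l = l' iff l R ij (each bounded class has
-- exactly one element of 𝒮, namely its largest element).
mulCoord : ℕ → ℕ → ℕ → ℕ → ℤ
mulCoord n i j l = if ⌊ (i * j ≤? n) ×-dec (dv n l ≟ dv n (i * j)) ⌋ then + 1 else + 0

-- ρ(𝐤): column j holds the coordinates of 𝐤𝐣, i.e. ρ(𝐤)_{l,j} = coord_l(𝐤𝐣)
ρ : ℕ → ℕ → Mat
ρ n k l j = mulCoord n k j l

{-# OPTIONS --safe #-}
-- ⌊n/·⌋ is a Galois connection on the positive integers (a ≤ ⌊n/b⌋ iff ab ≤ n), so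
-- m ↦ ⌊n/⌊n/m⌋⌋ is a closure operator whose fixed points are exactly the elements of 𝒮,
-- and ⌊n/·⌋ restricts to an order-reversing involution of 𝒮.  Hence ⌊n/i⌋ sits at position
-- s + 1 − pos(i) in 𝒮, and T_{i,l} = 1 iff l ≤ ⌊n/i⌋.  Column 𝐣 of ρ(𝐤) is the basis vector
-- of the closure ℓ of kj (or zero when kj > n), so (Tρ(𝐤))_{i,j} = T_{i,ℓ}, which is 1 iff
-- ℓ ≤ ⌊n/i⌋, iff kj ≤ ⌊n/i⌋, iff ijk ≤ n.
module Submission where

open import Defs
open import Data.Nat using (ℕ; _*_; _≤_)
open import Data.Integer using (+_)
open import Data.Product using (_×_)
open import Data.List.Membership.Propositional using (_∈_)
open import Function.Bundles using (_⇔_)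
open import Relation.Binary.PropositionalEquality using (_≡_)

open import Level using (0ℓ)
open import Data.Nat using (suc; _+_; _<_; _≤?_; s≤s; z≤n; >-nonZero)
open import Data.Nat.Properties
open import Data.Nat.DivMod using (_/_; m/n*n≤m; m*n/n≡m; m/n≤m; /-monoˡ-≤; /-monoʳ-≤)
open import Data.Nat.Solver using (module +-*-Solver)
open import Data.Integer using (ℤ) renaming (_+_ to _+ℤ_; _*_ to _*ℤ_)
import Data.Integer.Properties as ℤ
open import Data.Product using (_,_; proj₁; proj₂)
open import Data.Bool using (if_then_else_)
open import Data.List using (List; []; _∷_; filter; length; map; foldr; upTo)
open import Data.List.Properties using (length-map; map-id-local; map-∘)
open import Data.List.Membership.Propositional.Properties
  using (∈-filter⁺; ∈-filter⁻; ∈-map⁺; ∈-map⁻; ∈-upTo⁺; ∈-upTo⁻)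
open import Data.List.Membership.Propositional.Properties.WithK using (unique∧set⇒bag)
open import Data.List.Relation.Binary.BagAndSetEquality using (∼bag⇒↭)
open import Data.List.Relation.Binary.Permutation.Propositional.Properties using (↭-length)
open import Data.List.Relation.Unary.Any using (here; there)
import Data.List.Relation.Unary.All as All
open import Data.List.Relation.Unary.Unique.Propositional using (Unique; _∷_)
import Data.List.Relation.Unary.Unique.Propositional.Properties as Unique
open import Function.Base using (_∘_)
open import Function.Bundles using (mk⇔; Equivalence)
open import Function.Properties.Equivalence using (⇔-setoid)
open import Relation.Binary.PropositionalEquality
  using (_≢_; refl; sym; trans; cong; cong₂; subst; module ≡-Reasoning)
import Relation.Binary.Reasoning.Setoid as SetoidReasoning
open import Relation.Nullary using (Dec; yes; no; ¬_; ¬?; _×-dec_; contradiction)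
open import Relation.Nullary.Decidable using (⌊_⌋)
open import Relation.Unary using (Pred; Decidable)
open import Relation.Unary.Properties using (∁?)

open Equivalence using (to; from)

module _ {a p} {A : Set a} {P : Pred A p} (P? : Decidable P) where

  length-filter+filter-∁ : ∀ xs → length (filter P? xs) + length (filter (∁? P?) xs) ≡ length xs
  length-filter+filter-∁ [] = refl
  length-filter+filter-∁ (x ∷ xs) with P? x
  ... | yes _ = cong suc (length-filter+filter-∁ xs)
  ... | no _  = trans (+-suc _ _) (cong suc (length-filter+filter-∁ xs))

Unique-map-involutive : ∀ {a} {A : Set a} {f : A → A} {xs : List A} →
  All.All (λ x → f (f x) ≡ x) xs → Unique xs → Unique (map f xs)
Unique-map-involutive {f = f} {xs} invol u =
  Unique.map⁻ {f = f} (subst Unique (trans (sym (map-id-local {f = f ∘ f} invol)) (map-∘ xs)) u)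

module _ {a p q} {A : Set a} {P : Pred A p} {Q : Pred A q} (P? : Decidable P) (Q? : Decidable Q)
         (P⇒Q : ∀ {x} → P x → Q x) where

  length-filter-mono : ∀ xs → length (filter P? xs) ≤ length (filter Q? xs)
  length-filter-mono []       = z≤n
  length-filter-mono (x ∷ xs) with P? x | Q? x
  ... | yes _  | yes _  = s≤s (length-filter-mono xs)
  ... | yes px | no ¬qx = contradiction (P⇒Q px) ¬qx
  ... | no _   | yes _  = m≤n⇒m≤1+n (length-filter-mono xs)
  ... | no _   | no _   = length-filter-mono xs

  length-filter-mono-< : ∀ {xs y} → y ∈ xs → Q y → ¬ P y → length (filter P? xs) < length (filter Q? xs)
  length-filter-mono-< {x ∷ xs} y∈ qy ¬py with P? x | Q? x | y∈
  ... | _      | no ¬qx | here refl = contradiction qy ¬qx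
  ... | yes px | _      | here refl = contradiction px ¬py
  ... | no _   | yes _  | here refl = s≤s (length-filter-mono xs)
  ... | yes _  | yes _  | there y∈′ = s≤s (length-filter-mono-< y∈′ qy ¬py)
  ... | yes px | no ¬qx | there _   = contradiction (P⇒Q px) ¬qx
  ... | no _   | yes _  | there y∈′ = m<n⇒m<1+n (length-filter-mono-< y∈′ qy ¬py)
  ... | no _   | no _   | there y∈′ = length-filter-mono-< y∈′ qy ¬py

length-filter-≤?-≤⇔ : ∀ {xs b} a → b ∈ xs →
  length (filter (_≤? b) xs) ≤ length (filter (_≤? a) xs) ⇔ b ≤ a
length-filter-≤?-≤⇔ {xs} {b} a b∈ = mk⇔
  (λ le → ≮⇒≥ λ a<b → <⇒≱ (length-filter-mono-< (_≤? a) (_≤? b) (λ x≤a → ≤-trans x≤a (<⇒≤ a<b))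
                              b∈ ≤-refl (<⇒≱ a<b)) le)
  (λ b≤a → length-filter-mono (_≤? b) (_≤? a) (λ x≤b → ≤-trans x≤b b≤a) xs)

𝟙 : ∀ {p} {P : Set p} → Dec P → ℤ
𝟙 d = if ⌊ d ⌋ then + 1 else + 0

𝟙≡1⇔ : ∀ {p} {P : Set p} (d : Dec P) → 𝟙 d ≡ + 1 ⇔ P
𝟙≡1⇔ (yes p) = mk⇔ (λ _ → p) (λ _ → refl)
𝟙≡1⇔ (no ¬p) = mk⇔ (λ ()) (λ p → contradiction p ¬p)

𝟙≡0 : ∀ {p} {P : Set p} (d : Dec P) → ¬ P → 𝟙 d ≡ + 0
𝟙≡0 (yes p) ¬p = contradiction p ¬p
𝟙≡0 (no _)  _  = refl

-- mmul n A B i j unfolds to sumBy (λ l → A i l *ℤ B l j) (Slist n).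
sumBy : (ℕ → ℤ) → List ℕ → ℤ
sumBy F = foldr (λ l acc → F l +ℤ acc) (+ 0)

sumBy-zero : ∀ F xs → (∀ {l} → l ∈ xs → F l ≡ + 0) → sumBy F xs ≡ + 0
sumBy-zero F []       _    = refl
sumBy-zero F (x ∷ xs) zero = cong₂ _+ℤ_ (zero (here refl)) (sumBy-zero F xs (zero ∘ there))

sumBy-single : ∀ F {xs x} → Unique xs → x ∈ xs → (∀ {l} → l ∈ xs → l ≢ x → F l ≡ + 0) →
  sumBy F xs ≡ F x
sumBy-single F {y ∷ xs} (y∉ ∷ _) (here refl) zero = trans
  (cong (F y +ℤ_) (sumBy-zero F xs λ l∈ → zero (there l∈) λ l≡y → All.lookup y∉ l∈ (sym l≡y)))
  (ℤ.+-identityʳ (F y))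
sumBy-single F {y ∷ xs} (y∉ ∷ u) (there x∈) zero = trans
  (cong (_+ℤ sumBy F xs) (zero (here refl) (All.lookup y∉ x∈)))
  (trans (ℤ.+-identityˡ _) (sumBy-single F u x∈ (zero ∘ there)))

≤dv⇔*≤ : ∀ n a {b} → 1 ≤ b → a ≤ dv n b ⇔ a * b ≤ n
≤dv⇔*≤ n a {suc b} _ = mk⇔
  (λ a≤ → ≤-trans (*-monoˡ-≤ (suc b) a≤) (m/n*n≤m n (suc b)))
  (λ ab≤n → subst (_≤ n / suc b) (m*n/n≡m a (suc b)) (/-monoˡ-≤ (suc b) ab≤n))

≤dv-swap : ∀ n {a b} → 1 ≤ a → 1 ≤ b → a ≤ dv n b → b ≤ dv n a
≤dv-swap n {a} {b} 1≤a 1≤b a≤ =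
  from (≤dv⇔*≤ n b 1≤a) (subst (_≤ n) (*-comm a b) (to (≤dv⇔*≤ n a 1≤b) a≤))

dv-antimono : ∀ n {a b} → 1 ≤ a → a ≤ b → dv n b ≤ dv n a
dv-antimono n {suc a} {suc b} _ a≤b = /-monoʳ-≤ n a≤b

dv≤ : ∀ n m → dv n m ≤ n
dv≤ n 0       = z≤n
dv≤ n (suc m) = m/n≤m n (suc m)

1≤dv : ∀ n {m} → 1 ≤ m → m ≤ n → 1 ≤ dv n m
1≤dv n {m} 1≤m m≤n = from (≤dv⇔*≤ n 1 1≤m) (subst (_≤ n) (sym (*-identityˡ m)) m≤n)

≤dvdv : ∀ n {m} → 1 ≤ m → m ≤ n → m ≤ dv n (dv n m)
≤dvdv n 1≤m m≤n = ≤dv-swap n (1≤dv n 1≤m m≤n) 1≤m ≤-refl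

dvdvdv≡dv : ∀ n {m} → 1 ≤ m → m ≤ n → dv n (dv n (dv n m)) ≡ dv n m
dvdvdv≡dv n {m} 1≤m m≤n = ≤-antisym
  (dv-antimono n 1≤m (≤dvdv n 1≤m m≤n))
  (≤dvdv n (1≤dv n 1≤m m≤n) (dv≤ n m))

-- m is the largest element of its bounded class iff it is a fixed point of m ↦ ⌊n/⌊n/m⌋⌋.
IsLargest : ℕ → ℕ → Set
IsLargest n m = 1 ≤ m × dv n (dv n m) ≡ m

IsLargest⇒≤ : ∀ n {m} → IsLargest n m → m ≤ n
IsLargest⇒≤ n {m} (_ , fixed) = subst (_≤ n) fixed (dv≤ n (dv n m))

IsLargest-dvdv : ∀ n {m} → 1 ≤ m → m ≤ n → IsLargest n (dv n (dv n m))
IsLargest-dvdv n {m} 1≤m m≤n =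
  ≤-trans 1≤m (≤dvdv n 1≤m m≤n) , cong (dv n) (dvdvdv≡dv n 1≤m m≤n)

IsLargest-dv : ∀ n {m} → IsLargest n m → IsLargest n (dv n m)
IsLargest-dv n {m} l@(1≤m , fixed) =
  subst (IsLargest n) (cong (dv n) fixed) (IsLargest-dvdv n 1≤d (dv≤ n m))
  where 1≤d = 1≤dv n 1≤m (IsLargest⇒≤ n l)

dvdv-≤⇔ : ∀ n {c m} → IsLargest n c → 1 ≤ m → m ≤ n → dv n (dv n m) ≤ c ⇔ m ≤ c
dvdv-≤⇔ n {c} {m} l@(1≤c , fixed) 1≤m m≤n = mk⇔
  (≤-trans (≤dvdv n 1≤m m≤n))
  (λ m≤c → subst (dv n (dv n m) ≤_) fixed
    (dv-antimono n (1≤dv n 1≤c (IsLargest⇒≤ n l)) (dv-antimono n 1≤m m≤c)))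

∈Slist⇔ : ∀ n {m} → m ∈ Slist n ⇔ (1 ≤ m × m ≤ n × dv n (suc m) ≢ dv n m)
∈Slist⇔ n {m} = mk⇔ unfold fold
  where
  jump? = λ k → ¬? (dv n (suc k) ≟ dv n k)
  unfold : m ∈ Slist n → 1 ≤ m × m ≤ n × dv n (suc m) ≢ dv n m
  unfold m∈ with m∈map , jump ← ∈-filter⁻ jump? {xs = map suc (upTo n)} m∈
            with k , k∈ , refl ← ∈-map⁻ suc m∈map = s≤s z≤n , ∈-upTo⁻ k∈ , jump
  fold : 1 ≤ m × m ≤ n × dv n (suc m) ≢ dv n m → m ∈ Slist n
  fold (s≤s _ , m≤n , jump) = ∈-filter⁺ jump? (∈-map⁺ suc (∈-upTo⁺ m≤n)) jump

∈Slist⇔IsLargest : ∀ n {m} → m ∈ Slist n ⇔ IsLargest n m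
∈Slist⇔IsLargest n {m} = mk⇔
  (λ m∈ → let 1≤m , m≤n , jump = to (∈Slist⇔ n) m∈ in 1≤m , fixed 1≤m m≤n jump)
  (λ l → from (∈Slist⇔ n) (proj₁ l , IsLargest⇒≤ n l , jumps l))
  where
  -- Were m < ⌊n/⌊n/m⌋⌋, the class of m would contain m + 1.
  fixed : 1 ≤ m → m ≤ n → dv n (suc m) ≢ dv n m → dv n (dv n m) ≡ m
  fixed 1≤m m≤n jump = ≤-antisym (≮⇒≥ λ m<cl → jump (≤-antisym
    (dv-antimono n 1≤m (n≤1+n m))
    (subst (_≤ dv n (suc m)) (dvdvdv≡dv n 1≤m m≤n) (dv-antimono n (s≤s z≤n) m<cl))))
    (≤dvdv n 1≤m m≤n)
  jumps : IsLargest n m → dv n (suc m) ≢ dv n m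
  jumps l@(1≤m , m-fixed) same = <-irrefl refl (subst (suc m ≤_) (trans (cong (dv n) same) m-fixed)
    (≤dv-swap n (subst (1 ≤_) (sym same) (1≤dv n 1≤m (IsLargest⇒≤ n l))) (s≤s z≤n) ≤-refl))

∈Slist⇒IsLargest : ∀ n {m} → m ∈ Slist n → IsLargest n m
∈Slist⇒IsLargest n = to (∈Slist⇔IsLargest n)

IsLargest⇒∈Slist : ∀ n {m} → IsLargest n m → m ∈ Slist n
IsLargest⇒∈Slist n = from (∈Slist⇔IsLargest n)

∈Slist⇒1≤ : ∀ n {m} → m ∈ Slist n → 1 ≤ m
∈Slist⇒1≤ n = proj₁ ∘ ∈Slist⇒IsLargest n

Slist-unique : ∀ n → Unique (Slist n)
Slist-unique n = Unique.filter⁺ _ (Unique.map⁺ suc-injective (Unique.upTo⁺ n))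

-- The elements of 𝒮 up to ⌊n/i⌋ are mapped by m ↦ ⌊n/m⌋ onto i and the elements beyond i.
pos-dv : ∀ n {i} → i ∈ Slist n → pos n (dv n i) ≡ suc (length (filter (∁? (_≤? i)) (Slist n)))
pos-dv n {i} i∈ = begin
  pos n (dv n i)              ≡⟨ sym (length-map (dv n) (below (dv n i))) ⟩
  length (map (dv n) (below (dv n i)))
    ≡⟨ ↭-length (∼bag⇒↭ (unique∧set⇒bag unique-image unique-beyond same-elements)) ⟩
  length (i ∷ beyond)         ∎
  where
  open ≡-Reasoning
  S = Slist n
  below = λ c → filter (_≤? c) S
  beyond = filter (∁? (_≤? i)) S
  Li = ∈Slist⇒IsLargest n i∈
  unique-image : Unique (map (dv n) (below (dv n i)))
  unique-image = Unique-map-involutive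
    (All.tabulate (λ m∈ → proj₂ (∈Slist⇒IsLargest n (proj₁ (∈-filter⁻ (_≤? dv n i) m∈)))))
    (Unique.filter⁺ _ (Slist-unique n))
  unique-beyond : Unique (i ∷ beyond)
  unique-beyond =
    All.tabulate (λ m∈ i≡m → proj₂ (∈-filter⁻ (∁? (_≤? i)) {xs = S} m∈) (≤-reflexive (sym i≡m)))
    ∷ Unique.filter⁺ _ (Slist-unique n)
  same-elements : ∀ {x} → x ∈ map (dv n) (below (dv n i)) ⇔ x ∈ i ∷ beyond
  same-elements {x} = mk⇔ image⊆ ⊆image
    where
    image⊆ : x ∈ map (dv n) (below (dv n i)) → x ∈ i ∷ beyond
    image⊆ x∈ with m , m∈below , refl ← ∈-map⁻ (dv n) x∈
              with m∈ , m≤ ← ∈-filter⁻ (_≤? dv n i) m∈below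
              with i ≟ dv n m
    ... | yes i≡ = here (sym i≡)
    ... | no i≢  = there (∈-filter⁺ (∁? (_≤? i))
      (IsLargest⇒∈Slist n (IsLargest-dv n (∈Slist⇒IsLargest n m∈)))
      λ dvm≤i → i≢ (≤-antisym (≤dv-swap n (∈Slist⇒1≤ n m∈) (proj₁ Li) m≤) dvm≤i))
    ⊆image : x ∈ i ∷ beyond → x ∈ map (dv n) (below (dv n i))
    ⊆image (here refl) = subst (_∈ map (dv n) (below (dv n i))) (proj₂ Li)
      (∈-map⁺ (dv n) (∈-filter⁺ (_≤? dv n i) (IsLargest⇒∈Slist n (IsLargest-dv n Li)) ≤-refl))
    ⊆image (there x∈beyond) with x∈ , i≮x ← ∈-filter⁻ (∁? (_≤? i)) x∈beyond =
      subst (_∈ map (dv n) (below (dv n i))) (proj₂ Lx)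
        (∈-map⁺ (dv n) (∈-filter⁺ (_≤? dv n i) (IsLargest⇒∈Slist n (IsLargest-dv n Lx))
          (dv-antimono n (proj₁ Li) (<⇒≤ (≰⇒> i≮x)))))
      where Lx = ∈Slist⇒IsLargest n x∈

pos+pos-dv : ∀ n {i} → i ∈ Slist n → pos n i + pos n (dv n i) ≡ suc (card n)
pos+pos-dv n {i} i∈ = begin
  pos n i + pos n (dv n i)       ≡⟨ cong (_+_ (pos n i)) (pos-dv n i∈) ⟩
  pos n i + suc (length beyond)  ≡⟨ +-suc (pos n i) (length beyond) ⟩
  suc (pos n i + length beyond)  ≡⟨ cong suc (length-filter+filter-∁ (_≤? i) (Slist n)) ⟩
  suc (card n)                   ∎
  where
  open ≡-Reasoning
  beyond = filter (∁? (_≤? i)) (Slist n)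

T≡1⇔ : ∀ n {i l} → i ∈ Slist n → l ∈ Slist n → T n i l ≡ + 1 ⇔ l ≤ dv n i
T≡1⇔ n {i} {l} i∈ l∈ = begin
  T n i l ≡ + 1                                ≈⟨ 𝟙≡1⇔ (pos n i + pos n l ≤? suc (card n)) ⟩
  pos n i + pos n l ≤ suc (card n)             ≡⟨ cong (pos n i + pos n l ≤_) (sym (pos+pos-dv n i∈)) ⟩
  pos n i + pos n l ≤ pos n i + pos n (dv n i) ≈⟨ mk⇔ (+-cancelˡ-≤ (pos n i) _ _) (+-monoʳ-≤ (pos n i)) ⟩
  pos n l ≤ pos n (dv n i)                     ≈⟨ length-filter-≤?-≤⇔ (dv n i) l∈ ⟩
  l ≤ dv n i                                   ∎
  where open SetoidReasoning (⇔-setoid 0ℓ)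

Tρ-entry≡0 : ∀ n {k i j} → ¬ k * j ≤ n → mmul n (T n) (ρ n k) i j ≡ + 0
Tρ-entry≡0 n {k} {i} {j} kj≰n = sumBy-zero _ (Slist n) λ {l} _ → trans
  (cong (T n i l *ℤ_) (𝟙≡0 ((k * j ≤? n) ×-dec (dv n l ≟ dv n (k * j))) (kj≰n ∘ proj₁)))
  (ℤ.*-zeroʳ (T n i l))

Tρ-entry≡T : ∀ n {k i j} → 1 ≤ k * j → k * j ≤ n →
  mmul n (T n) (ρ n k) i j ≡ T n i (dv n (dv n (k * j)))
Tρ-entry≡T n {k} {i} {j} 1≤kj kj≤n = begin
  mmul n (T n) (ρ n k) i j        ≡⟨ sumBy-single _ (Slist-unique n) ℓ∈ off-support ⟩
  T n i ℓ *ℤ ρ n k ℓ j            ≡⟨ cong (T n i ℓ *ℤ_) (from (𝟙≡1⇔ (coord? ℓ)) (kj≤n , ℓ-fixed)) ⟩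
  T n i ℓ *ℤ + 1                  ≡⟨ ℤ.*-identityʳ (T n i ℓ) ⟩
  T n i ℓ                         ∎
  where
  open ≡-Reasoning
  ℓ = dv n (dv n (k * j))
  ℓ-fixed : dv n ℓ ≡ dv n (k * j)
  ℓ-fixed = dvdvdv≡dv n 1≤kj kj≤n
  ℓ∈ : ℓ ∈ Slist n
  ℓ∈ = IsLargest⇒∈Slist n (IsLargest-dvdv n 1≤kj kj≤n)
  coord? = λ l → (k * j ≤? n) ×-dec (dv n l ≟ dv n (k * j))
  off-support : ∀ {l} → l ∈ Slist n → l ≢ ℓ → T n i l *ℤ ρ n k l j ≡ + 0
  off-support {l} l∈ l≢ℓ = trans
    (cong (T n i l *ℤ_) (𝟙≡0 (coord? l) λ (_ , same) →
      l≢ℓ (trans (sym (proj₂ (∈Slist⇒IsLargest n l∈))) (cong (dv n) same))))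
    (ℤ.*-zeroʳ (T n i l))

Tρ-entry≡1⇔ : ∀ n {k i j} → k ∈ Slist n → i ∈ Slist n → j ∈ Slist n →
  mmul n (T n) (ρ n k) i j ≡ + 1 ⇔ k * j * i ≤ n
Tρ-entry≡1⇔ n {k} {i} {j} k∈ i∈ j∈ = by-cases (k * j ≤? n)
  where
  open SetoidReasoning (⇔-setoid 0ℓ)
  Li = ∈Slist⇒IsLargest n i∈
  1≤kj = *-mono-≤ (∈Slist⇒1≤ n k∈) (∈Slist⇒1≤ n j∈)
  by-cases : Dec (k * j ≤ n) → mmul n (T n) (ρ n k) i j ≡ + 1 ⇔ k * j * i ≤ n
  by-cases (no kj≰n) = mk⇔
    (λ entry≡1 → contradiction (trans (sym (Tρ-entry≡0 n {k} {i} {j} kj≰n)) entry≡1) λ ())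
    (λ kji≤n → contradiction (≤-trans (m≤m*n (k * j) i {{>-nonZero (proj₁ Li)}}) kji≤n) kj≰n)
  by-cases (yes kj≤n) = begin
    mmul n (T n) (ρ n k) i j ≡ + 1    ≡⟨ cong (_≡ + 1) (Tρ-entry≡T n {k} {i} {j} 1≤kj kj≤n) ⟩
    T n i (dv n (dv n (k * j))) ≡ + 1 ≈⟨ T≡1⇔ n i∈ (IsLargest⇒∈Slist n (IsLargest-dvdv n 1≤kj kj≤n)) ⟩
    dv n (dv n (k * j)) ≤ dv n i      ≈⟨ dvdv-≤⇔ n (IsLargest-dv n Li) 1≤kj kj≤n ⟩
    k * j ≤ dv n i                    ≈⟨ ≤dv⇔*≤ n (k * j) (proj₁ Li) ⟩
    k * j * i ≤ n                     ∎

lemma2 : (n : ℕ) → 1 ≤ n → (k i j : ℕ) → k ∈ Slist n → i ∈ Slist n → j ∈ Slist n →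
    ((mmul n (T n) (ρ n k) i j ≡ + 1) ⇔ (i * j ≤ dv n k))
    × ((i * j ≤ dv n k) ⇔ (k ≤ dv n (i * j)))
lemma2 n _ k i j k∈ i∈ j∈ = entry , mk⇔ (≤dv-swap n 1≤ij 1≤k) (≤dv-swap n 1≤k 1≤ij)
  where
  open SetoidReasoning (⇔-setoid 0ℓ)
  1≤k = ∈Slist⇒1≤ n k∈
  1≤ij = *-mono-≤ (∈Slist⇒1≤ n i∈) (∈Slist⇒1≤ n j∈)
  entry : mmul n (T n) (ρ n k) i j ≡ + 1 ⇔ i * j ≤ dv n k
  entry = begin
    mmul n (T n) (ρ n k) i j ≡ + 1 ≈⟨ Tρ-entry≡1⇔ n k∈ i∈ j∈ ⟩
    k * j * i ≤ n                  ≡⟨ cong (_≤ n) (solve 3 (λ k i j → (k :* j) :* i := (i :* j) :* k) refl k i j) ⟩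
    i * j * k ≤ n                  ≈⟨ ≤dv⇔*≤ n (i * j) 1≤k ⟨
    i * j ≤ dv n k                 ∎
    where open +-*-Solver
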